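{- (1) Let $(G,*,\sqcup,\sqcap)$ be an algebraic mixed lattice group, and define $x\sqsubseteq y\iff y\sqcap x=x$ and $x\leq y\iff x\sqcap y=x$. Then $(G,*,\leq,\sqsubseteq)$ is an order-theoretic mixed lattice group in which, for all $x,y\in G$, $x\leq y\iff y\,\overline{\vee}\,x=y\iff x\,\underline{\wedge}\,y=x$ (with $\overline{\vee},\underline{\wedge}$ its mixed envelopes). (2) Conversely, if $(G,*,\leq,\sqsubseteq)$ is an order-theoretic mixed lattice group such that $x\leq y\iff y\,\overline{\vee}\,x=y\iff x\,\underline{\wedge}\,y=x$ for all $x,y\in G$, and $\overline{\vee},\underline{\wedge}$ are its mixed envelopes, then $(G,*,\overline{\vee},\underline{\wedge})$ is an algebraic mixed lattice group.
   Context: Order-theoretic mixed lattice: a set $M$ with two partial orderings $\leq,\sqsubseteq$ such that for all $x,y$ the mixed upper envelope $x\,\overline{\vee}\,y=\min\{w: x\sqsubseteq w,\ y\leq w\}$ and mixed lower envelope $x\,\underline{\wedge}\,y=\max\{w: w\sqsubseteq x,\ w\leq y\}$ exist (min and max with respect to $\leq$). An order-theoretic mixed lattice group is a commutative group $(G,*)$ with two partial orderings $\leq,\sqsubseteq$ such that each is translation invariant ($x\leq y$ implies $x*z\leq y*z$ for all $z$, and likewise for $\sqsubseteq$), and $(G,\leq,\sqsubseteq)$ is an order-theoretic mixed lattice. Mixed lattice algebra: an algebra $(M,\sqcup,\sqcap)$ with binary operations (not assumed commutative or associative) such that for all $x,y,z$: (M1) $x\sqcup y=x\sqcap y \iff x=y$;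 (M2a) $(x\sqcap y)\sqcup x=x$ and $(x\sqcup y)\sqcap x=x$; (M2b) $x\sqcup(y\sqcap x)=x$ and $x\sqcap(y\sqcup x)=x$; (M3a) $z\sqcap(x\sqcup y)=[z\sqcap(x\sqcup y)]\sqcup(z\sqcap y)$; (M3b) $z\sqcup(x\sqcap y)=[z\sqcup(x\sqcap y)]\sqcap(z\sqcup y)$; (M4a) $(x\sqcup y)\sqcap z=[(x\sqcup y)\sqcap z]\sqcup(x\sqcap z)$; (M4b) $(x\sqcap y)\sqcup z=[(x\sqcap y)\sqcup z]\sqcap(x\sqcup z)$. An algebraic mixed lattice group is a commutative group $(G,*)$ with binary operations $\sqcup,\sqcap$ such that $(G,\sqcup,\sqcap)$ is a mixed lattice algebra and $(x\sqcup y)*z=(x*z)\sqcup(y*z)$ and $(x\sqcap y)*z=(x*z)\sqcap(y*z)$ for all $x,y,z\in G$. -}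

module Defs where

open import Level using (Level; _⊔_; suc)
open import Data.Product using (Σ; _×_; proj₁; _,_)
open import Function.Bundles using (_⇔_)
open import Relation.Binary.Core using (Rel)
open import Relation.Binary.Structures using (IsPartialOrder)
open import Relation.Binary.PropositionalEquality using (_≡_)
open import Algebra.Core using (Op₁; Op₂)
open import Algebra.Structures using (IsAbelianGroup)

module _ {a ℓ₁ ℓ₂ : Level} {G : Set a} where

  IsUpperEnvelope : Rel G ℓ₁ → Rel G ℓ₂ → G → G → G → Set (a ⊔ ℓ₁ ⊔ ℓ₂)
  IsUpperEnvelope _≤_ _⊑_ x y w =
    (x ⊑ w) × (y ≤ w) × (∀ v → x ⊑ v → y ≤ v → w ≤ v)

  IsLowerEnvelope : Rel G ℓ₁ → Rel G ℓ₂ → G → G → G → Set (a ⊔ ℓ₁ ⊔ ℓ₂)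
  IsLowerEnvelope _≤_ _⊑_ x y w =
    (w ⊑ x) × (w ≤ y) × (∀ v → v ⊑ x → v ≤ y → v ≤ w)

  record IsOrderMixedLattice (_≤_ : Rel G ℓ₁) (_⊑_ : Rel G ℓ₂) : Set (a ⊔ ℓ₁ ⊔ ℓ₂) where
    field
      ≤-isPartialOrder : IsPartialOrder _≡_ _≤_
      ⊑-isPartialOrder : IsPartialOrder _≡_ _⊑_
      upperEnvelope    : ∀ x y → Σ G (IsUpperEnvelope _≤_ _⊑_ x y)
      lowerEnvelope    : ∀ x y → Σ G (IsLowerEnvelope _≤_ _⊑_ x y)

    _∨̄_ : G → G → G
    x ∨̄ y = proj₁ (upperEnvelope x y)

    _∧̲_ : G → G → G
    x ∧̲ y = proj₁ (lowerEnvelope x y)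

  record IsOrderMixedLatticeGroup (_*_ : Op₂ G) (ε : G) (_⁻¹ : Op₁ G)
                                  (_≤_ : Rel G ℓ₁) (_⊑_ : Rel G ℓ₂) : Set (a ⊔ ℓ₁ ⊔ ℓ₂) where
    field
      isAbelianGroup  : IsAbelianGroup _≡_ _*_ ε _⁻¹
      ≤-translation   : ∀ x y z → x ≤ y → (x * z) ≤ (y * z)
      ⊑-translation   : ∀ x y z → x ⊑ y → (x * z) ⊑ (y * z)
      isMixedLattice  : IsOrderMixedLattice _≤_ _⊑_
    open IsOrderMixedLattice isMixedLattice public

module _ {a : Level} {G : Set a} where

  record IsMixedLatticeAlgebra (_⊔_ _⊓_ : Op₂ G) : Set a where
    field
      M1  : ∀ x y → ((x ⊔ y) ≡ (x ⊓ y)) ⇔ (x ≡ y)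
      M2a : ∀ x y → ((x ⊓ y) ⊔ x ≡ x) × ((x ⊔ y) ⊓ x ≡ x)
      M2b : ∀ x y → (x ⊔ (y ⊓ x) ≡ x) × (x ⊓ (y ⊔ x) ≡ x)
      M3a : ∀ x y z → z ⊓ (x ⊔ y) ≡ (z ⊓ (x ⊔ y)) ⊔ (z ⊓ y)
      M3b : ∀ x y z → z ⊔ (x ⊓ y) ≡ (z ⊔ (x ⊓ y)) ⊓ (z ⊔ y)
      M4a : ∀ x y z → (x ⊔ y) ⊓ z ≡ ((x ⊔ y) ⊓ z) ⊔ (x ⊓ z)
      M4b : ∀ x y z → (x ⊓ y) ⊔ z ≡ ((x ⊓ y) ⊔ z) ⊓ (x ⊔ z)

  record IsAlgebraicMixedLatticeGroup (_*_ : Op₂ G) (ε : G) (_⁻¹ : Op₁ G)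
                                      (_⊔_ _⊓_ : Op₂ G) : Set a where
    field
      isAbelianGroup          : IsAbelianGroup _≡_ _*_ ε _⁻¹
      isMixedLatticeAlgebra   : IsMixedLatticeAlgebra _⊔_ _⊓_
      ⊔-translation           : ∀ x y z → (x ⊔ y) * z ≡ (x * z) ⊔ (y * z)
      ⊓-translation           : ∀ x y z → (x ⊓ y) * z ≡ (x * z) ⊓ (y * z)

module _ {a : Level} {G : Set a} where

  InducedSpecific : Op₂ G → Rel G a
  InducedSpecific _⊓_ x y = (y ⊓ x) ≡ x

  InducedInitial : Op₂ G → Rel G a
  InducedInitial _⊓_ x y = (x ⊓ y) ≡ x

module _ {a ℓ₁ ℓ₂ : Level} {G : Set a} where

  EnvelopeCondition : (_≤_ : Rel G ℓ₁) (_⊑_ : Rel G ℓ₂) → IsOrderMixedLattice _≤_ _⊑_ → Set (a ⊔ ℓ₁)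
  EnvelopeCondition _≤_ _⊑_ L =
    ∀ x y → ((x ≤ y) ⇔ ((y ∨̄ x) ≡ y)) × ((x ≤ y) ⇔ ((x ∧̲ y) ≡ x))
    where open IsOrderMixedLattice L

-- (1) The absorption laws M2 identify x ≤ y with y ⊔ x = y and x ⊑ y with x ⊔ y = y, and M1 gives
-- antisymmetry.  M3b says that x ⊔ – is ≤-monotone and M4a that – ⊓ z turns ⊑ into ≤; transitivity
-- of both orders and the extremality of x ⊔ y and x ⊓ y follow.
-- (2) Under the envelope condition each of M3/M4 asserts that one envelope lies ≤-below another,
-- which the extremal properties of the envelopes provide.
-- In both directions translation invariance transfers because x ↦ x * z is an isomorphism of both
-- orders, with inverse x ↦ x * z⁻¹.
module Submission where

open import Defs
open import Level using (Level)
open import Data.Product using (Σ; _×_; _,_; proj₁; proj₂)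
open import Function using (id)
open import Function.Bundles using (mk⇔; Equivalence)
open import Relation.Binary.Core using (Rel)
open import Relation.Binary.Definitions using (Monotonic₁)
open import Relation.Binary.Structures using (IsPartialOrder)
open import Relation.Binary.PropositionalEquality
open import Algebra.Bundles using (Group)
open import Algebra.Core using (Op₁; Op₂)
open import Algebra.Structures using (IsAbelianGroup)
import Algebra.Properties.Group as GroupProperties

module MixedLatticeAlgebraOrders {a : Level} {G : Set a} {_⊔_ _⊓_ : Op₂ G}
  (M : IsMixedLatticeAlgebra _⊔_ _⊓_) where
  open IsMixedLatticeAlgebra M

  _≤_ : Rel G a
  _≤_ = InducedInitial _⊓_

  _⊑_ : Rel G a
  _⊑_ = InducedSpecific _⊓_

  ⊓-idem : ∀ x → x ⊓ x ≡ x
  ⊓-idem x = trans (cong (x ⊓_) (sym (proj₁ (M2a x x)))) (proj₂ (M2b x (x ⊓ x)))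

  ≤⇒⊔≡ : ∀ {x y} → x ≤ y → y ⊔ x ≡ y
  ≤⇒⊔≡ {x} {y} x⊓y≡x = trans (cong (y ⊔_) (sym x⊓y≡x)) (proj₁ (M2b y x))

  ⊔≡⇒≤ : ∀ {x y} → y ⊔ x ≡ y → x ≤ y
  ⊔≡⇒≤ {x} {y} y⊔x≡y = trans (cong (x ⊓_) (sym y⊔x≡y)) (proj₂ (M2b x y))

  ⊑⇒⊔≡ : ∀ {x y} → x ⊑ y → x ⊔ y ≡ y
  ⊑⇒⊔≡ {x} {y} y⊓x≡x = trans (cong (_⊔ y) (sym y⊓x≡x)) (proj₁ (M2a y x))

  ⊔≡⇒⊑ : ∀ {x y} → x ⊔ y ≡ y → x ⊑ y
  ⊔≡⇒⊑ {x} {y} x⊔y≡y = trans (cong (_⊓ x) (sym x⊔y≡y)) (proj₂ (M2a x y))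

  ≤-antisym : ∀ {x y} → x ≤ y → y ≤ x → x ≡ y
  ≤-antisym x≤y y≤x = Equivalence.to (M1 _ _) (trans (≤⇒⊔≡ y≤x) (sym x≤y))

  ⊑-antisym : ∀ {x y} → x ⊑ y → y ⊑ x → x ≡ y
  ⊑-antisym x⊑y y⊑x = Equivalence.to (M1 _ _) (trans (⊑⇒⊔≡ x⊑y) (sym y⊑x))

  ⊔-monoʳ-≤ : ∀ {x y v} → y ≤ v → (x ⊔ y) ≤ (x ⊔ v)
  ⊔-monoʳ-≤ {x} {y} {v} y≤v = sym (subst (λ u → x ⊔ u ≡ (x ⊔ u) ⊓ (x ⊔ v)) y≤v (M3b y v x))

  ⊓-monoˡ-⊑ : ∀ {x w z} → x ⊑ w → (x ⊓ z) ≤ (w ⊓ z)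
  ⊓-monoˡ-⊑ {x} {w} {z} x⊑w =
    ⊔≡⇒≤ (sym (subst (λ u → u ⊓ z ≡ (u ⊓ z) ⊔ (x ⊓ z)) (⊑⇒⊔≡ x⊑w) (M4a x w z)))

  ≤-trans : ∀ {x y z} → x ≤ y → y ≤ z → x ≤ z
  ≤-trans {x} {y} {z} x≤y y≤z = ⊔≡⇒≤ (begin
    z ⊔ x             ≡⟨ ⊔-monoʳ-≤ x≤y ⟨
    (z ⊔ x) ⊓ (z ⊔ y) ≡⟨ cong ((z ⊔ x) ⊓_) (≤⇒⊔≡ y≤z) ⟩
    (z ⊔ x) ⊓ z       ≡⟨ proj₂ (M2a z x) ⟩
    z                 ∎)
    where open ≡-Reasoning

  x⊓y≤y : ∀ x y → (x ⊓ y) ≤ y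
  x⊓y≤y x y = ⊔≡⇒≤ (proj₁ (M2b y x))

  ⊑-trans : ∀ {x y z} → x ⊑ y → y ⊑ z → x ⊑ z
  ⊑-trans {x} {y} {z} x⊑y y⊑z =
    sym (≤-antisym (subst (_≤ (z ⊓ x)) x⊑y (⊓-monoˡ-⊑ y⊑z)) (x⊓y≤y z x))

  ≤-isPartialOrder : IsPartialOrder _≡_ _≤_
  ≤-isPartialOrder = record
    { isPreorder = record
      { isEquivalence = isEquivalence
      ; reflexive     = λ { {x} refl → ⊓-idem x }
      ; trans         = ≤-trans
      }
    ; antisym = ≤-antisym
    }

  ⊑-isPartialOrder : IsPartialOrder _≡_ _⊑_
  ⊑-isPartialOrder = record
    { isPreorder = record
      { isEquivalence = isEquivalence
      ; reflexive     = λ { {x} refl → ⊓-idem x }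
      ; trans         = ⊑-trans
      }
    ; antisym = ⊑-antisym
    }

  ⊔-isUpperEnvelope : ∀ x y → IsUpperEnvelope _≤_ _⊑_ x y (x ⊔ y)
  ⊔-isUpperEnvelope x y =
    proj₂ (M2a x y) , proj₂ (M2b y x) ,
    λ v x⊑v y≤v → subst ((x ⊔ y) ≤_) (⊑⇒⊔≡ x⊑v) (⊔-monoʳ-≤ y≤v)

  ⊓-isLowerEnvelope : ∀ x y → IsLowerEnvelope _≤_ _⊑_ x y (x ⊓ y)
  ⊓-isLowerEnvelope x y =
    ⊔≡⇒⊑ (proj₁ (M2a x y)) , x⊓y≤y x y ,
    λ v v⊑x v≤y → subst (_≤ (x ⊓ y)) v≤y (⊓-monoˡ-⊑ v⊑x)

  isOrderMixedLattice : IsOrderMixedLattice _≤_ _⊑_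
  isOrderMixedLattice = record
    { ≤-isPartialOrder = ≤-isPartialOrder
    ; ⊑-isPartialOrder = ⊑-isPartialOrder
    ; upperEnvelope    = λ x y → x ⊔ y , ⊔-isUpperEnvelope x y
    ; lowerEnvelope    = λ x y → x ⊓ y , ⊓-isLowerEnvelope x y
    }

  envelopeCondition : EnvelopeCondition _≤_ _⊑_ isOrderMixedLattice
  envelopeCondition x y = mk⇔ ≤⇒⊔≡ ⊔≡⇒≤ , mk⇔ id id

module AlgebraicMixedLatticeGroupOrders {a : Level} {G : Set a} {_*_ : Op₂ G} {ε : G}
  {_⁻¹ : Op₁ G} {_⊔_ _⊓_ : Op₂ G} (A : IsAlgebraicMixedLatticeGroup _*_ ε _⁻¹ _⊔_ _⊓_) where
  open IsAlgebraicMixedLatticeGroup A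
  open MixedLatticeAlgebraOrders isMixedLatticeAlgebra

  isOrderMixedLatticeGroup : IsOrderMixedLatticeGroup _*_ ε _⁻¹ _≤_ _⊑_
  isOrderMixedLatticeGroup = record
    { isAbelianGroup = isAbelianGroup
    ; ≤-translation  = λ x y z x⊓y≡x → trans (sym (⊓-translation x y z)) (cong (_* z) x⊓y≡x)
    ; ⊑-translation  = λ x y z y⊓x≡x → trans (sym (⊓-translation y x z)) (cong (_* z) y⊓x≡x)
    ; isMixedLattice = isOrderMixedLattice
    }

module OrderMixedLatticeEnvelopes {a ℓ₁ ℓ₂ : Level} {G : Set a} {_≤_ : Rel G ℓ₁} {_⊑_ : Rel G ℓ₂}
  (L : IsOrderMixedLattice _≤_ _⊑_) where
  open IsOrderMixedLattice L
  open IsPartialOrder ≤-isPartialOrder using ()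
    renaming (refl to ≤-refl; trans to ≤-trans; antisym to ≤-antisym)
  open IsPartialOrder ⊑-isPartialOrder using ()
    renaming (refl to ⊑-refl; trans to ⊑-trans; antisym to ⊑-antisym)

  x⊑x∨̄y : ∀ x y → x ⊑ (x ∨̄ y)
  x⊑x∨̄y x y = proj₁ (proj₂ (upperEnvelope x y))

  y≤x∨̄y : ∀ x y → y ≤ (x ∨̄ y)
  y≤x∨̄y x y = proj₁ (proj₂ (proj₂ (upperEnvelope x y)))

  ∨̄-least : ∀ {x y v} → x ⊑ v → y ≤ v → (x ∨̄ y) ≤ v
  ∨̄-least {x} {y} {v} = proj₂ (proj₂ (proj₂ (upperEnvelope x y))) v

  x∧̲y⊑x : ∀ x y → (x ∧̲ y) ⊑ x
  x∧̲y⊑x x y = proj₁ (proj₂ (lowerEnvelope x y))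

  x∧̲y≤y : ∀ x y → (x ∧̲ y) ≤ y
  x∧̲y≤y x y = proj₁ (proj₂ (proj₂ (lowerEnvelope x y)))

  ∧̲-greatest : ∀ {x y v} → v ⊑ x → v ≤ y → v ≤ (x ∧̲ y)
  ∧̲-greatest {x} {y} {v} = proj₂ (proj₂ (proj₂ (lowerEnvelope x y))) v

  ⊑⇒∨̄≡ : ∀ {x y} → x ⊑ y → x ∨̄ y ≡ y
  ⊑⇒∨̄≡ {x} {y} x⊑y = ≤-antisym (∨̄-least x⊑y ≤-refl) (y≤x∨̄y x y)

  ⊑⇒∧̲≡ : ∀ {x y} → y ⊑ x → x ∧̲ y ≡ y
  ⊑⇒∧̲≡ {x} {y} y⊑x = ≤-antisym (x∧̲y≤y x y) (∧̲-greatest y⊑x ≤-refl)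

  ∨̄≡∧̲⇒≡ : ∀ x y → x ∨̄ y ≡ x ∧̲ y → x ≡ y
  ∨̄≡∧̲⇒≡ x y e = trans
    (⊑-antisym (x⊑x∨̄y x y) (subst (_⊑ x) (sym e) (x∧̲y⊑x x y)))
    (≤-antisym (subst (_≤ y) (sym e) (x∧̲y≤y x y)) (y≤x∨̄y x y))

  module Automorphism (f g : G → G) (f∘g≗id : ∀ w → f (g w) ≡ w) (g∘f≗id : ∀ w → g (f w) ≡ w)
    (f-mono-≤ : Monotonic₁ _≤_ _≤_ f) (f-mono-⊑ : Monotonic₁ _⊑_ _⊑_ f)
    (g-mono-≤ : Monotonic₁ _≤_ _≤_ g) (g-mono-⊑ : Monotonic₁ _⊑_ _⊑_ g) where

    ∨̄-preserved : ∀ x y → f (x ∨̄ y) ≡ f x ∨̄ f y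
    ∨̄-preserved x y = ≤-antisym
      (subst (f (x ∨̄ y) ≤_) (f∘g≗id w) (f-mono-≤ (∨̄-least
        (subst (_⊑ g w) (g∘f≗id x) (g-mono-⊑ (x⊑x∨̄y (f x) (f y))))
        (subst (_≤ g w) (g∘f≗id y) (g-mono-≤ (y≤x∨̄y (f x) (f y)))))))
      (∨̄-least (f-mono-⊑ (x⊑x∨̄y x y)) (f-mono-≤ (y≤x∨̄y x y)))
      where w = f x ∨̄ f y

    ∧̲-preserved : ∀ x y → f (x ∧̲ y) ≡ f x ∧̲ f y
    ∧̲-preserved x y = ≤-antisym
      (∧̲-greatest (f-mono-⊑ (x∧̲y⊑x x y)) (f-mono-≤ (x∧̲y≤y x y)))
      (subst (_≤ f (x ∧̲ y)) (f∘g≗id w) (f-mono-≤ (∧̲-greatest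
        (subst (g w ⊑_) (g∘f≗id x) (g-mono-⊑ (x∧̲y⊑x (f x) (f y))))
        (subst (g w ≤_) (g∘f≗id y) (g-mono-≤ (x∧̲y≤y (f x) (f y)))))))
      where w = f x ∧̲ f y

  module _ (E : EnvelopeCondition _≤_ _⊑_ L) where

    ≤⇒∨̄≡ : ∀ {x y} → x ≤ y → y ∨̄ x ≡ y
    ≤⇒∨̄≡ {x} {y} = Equivalence.to (proj₁ (E x y))

    ≤⇒∧̲≡ : ∀ {x y} → x ≤ y → x ∧̲ y ≡ x
    ≤⇒∧̲≡ {x} {y} = Equivalence.to (proj₂ (E x y))

    isMixedLatticeAlgebra : IsMixedLatticeAlgebra _∨̄_ _∧̲_
    isMixedLatticeAlgebra = record
      { M1  = λ x y → mk⇔ (∨̄≡∧̲⇒≡ x y) (λ { refl → trans (⊑⇒∨̄≡ ⊑-refl) (sym (⊑⇒∧̲≡ ⊑-refl)) })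
      ; M2a = λ x y → ⊑⇒∨̄≡ (x∧̲y⊑x x y) , ⊑⇒∧̲≡ (x⊑x∨̄y x y)
      ; M2b = λ x y → ≤⇒∨̄≡ (x∧̲y≤y y x) , ≤⇒∧̲≡ (y≤x∨̄y y x)
      ; M3a = λ x y z → sym (≤⇒∨̄≡ (∧̲-greatest (x∧̲y⊑x z y) (≤-trans (x∧̲y≤y z y) (y≤x∨̄y x y))))
      ; M3b = λ x y z → sym (≤⇒∧̲≡ (∨̄-least (x⊑x∨̄y z y) (≤-trans (x∧̲y≤y x y) (y≤x∨̄y z y))))
      ; M4a = λ x y z → sym (≤⇒∨̄≡ (∧̲-greatest (⊑-trans (x∧̲y⊑x x z) (x⊑x∨̄y x y)) (x∧̲y≤y x z)))
      ; M4b = λ x y z → sym (≤⇒∧̲≡ (∨̄-least (⊑-trans (x∧̲y⊑x x y) (x⊑x∨̄y x z)) (y≤x∨̄y x z)))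
      }

module OrderMixedLatticeGroupAlgebra {a ℓ₁ ℓ₂ : Level} {G : Set a} {_*_ : Op₂ G} {ε : G}
  {_⁻¹ : Op₁ G} {_≤_ : Rel G ℓ₁} {_⊑_ : Rel G ℓ₂} (P : IsOrderMixedLatticeGroup _*_ ε _⁻¹ _≤_ _⊑_) where
  open IsOrderMixedLatticeGroup P
  open OrderMixedLatticeEnvelopes isMixedLattice

  group : Group a a
  group = record { isGroup = IsAbelianGroup.isGroup isAbelianGroup }

  open GroupProperties group using (//-rightDividesˡ; //-rightDividesʳ)

  module Translation (z : G) = Automorphism (_* z) (_* (z ⁻¹))
    (//-rightDividesˡ z) (//-rightDividesʳ z)
    (≤-translation _ _ z) (⊑-translation _ _ z) (≤-translation _ _ (z ⁻¹)) (⊑-translation _ _ (z ⁻¹))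

  isAlgebraicMixedLatticeGroup : EnvelopeCondition _≤_ _⊑_ isMixedLattice →
                                 IsAlgebraicMixedLatticeGroup _*_ ε _⁻¹ _∨̄_ _∧̲_
  isAlgebraicMixedLatticeGroup E = record
    { isAbelianGroup        = isAbelianGroup
    ; isMixedLatticeAlgebra = isMixedLatticeAlgebra E
    ; ⊔-translation         = λ x y z → Translation.∨̄-preserved z x y
    ; ⊓-translation         = λ x y z → Translation.∧̲-preserved z x y
    }

theorem3p6 : ∀ {a ℓ₁ ℓ₂ : Level}
    → ((G : Set a) (_*_ : Op₂ G) (ε : G) (_⁻¹ : Op₁ G) (_⊔′_ _⊓′_ : Op₂ G)
        → IsAlgebraicMixedLatticeGroup _*_ ε _⁻¹ _⊔′_ _⊓′_
        → Σ (IsOrderMixedLatticeGroup _*_ ε _⁻¹ (InducedInitial _⊓′_) (InducedSpecific _⊓′_))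
            (λ P → EnvelopeCondition (InducedInitial _⊓′_) (InducedSpecific _⊓′_)
                     (IsOrderMixedLatticeGroup.isMixedLattice P)))
    × ((G : Set a) (_*_ : Op₂ G) (ε : G) (_⁻¹ : Op₁ G) (_≤_ : Rel G ℓ₁) (_⊑_ : Rel G ℓ₂)
        → (P : IsOrderMixedLatticeGroup _*_ ε _⁻¹ _≤_ _⊑_)
        → EnvelopeCondition _≤_ _⊑_ (IsOrderMixedLatticeGroup.isMixedLattice P)
        → IsAlgebraicMixedLatticeGroup _*_ ε _⁻¹
            (IsOrderMixedLatticeGroup._∨̄_ P) (IsOrderMixedLatticeGroup._∧̲_ P))
theorem3p6 =
    (λ _ _ _ _ _ _ A →
         AlgebraicMixedLatticeGroupOrders.isOrderMixedLatticeGroup A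
       , MixedLatticeAlgebraOrders.envelopeCondition
           (IsAlgebraicMixedLatticeGroup.isMixedLatticeAlgebra A))
  , (λ _ _ _ _ _ _ P → OrderMixedLatticeGroupAlgebra.isAlgebraicMixedLatticeGroup P)
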